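{- Let $\lambda=(\lambda_1,\dots,\lambda_r)$ be a circular composition with translation parameters $s_i=\sum_{j>i}\lambda_j-\sum_{j<i}\lambda_j$, and let $t\in\{1,\dots,r\}$. If $\lambda_t>|s_t|$, then $\lambda_i<|s_i|$ for all $i\in\{1,\dots,r\}$ with $i\neq t$.
   Context: A composition of $n$ is a finite sequence $(\lambda_1,\dots,\lambda_r)$ of positive integers with sum $n$. For $\llbracket a,b\rrbracket=[a,b]\cap\mathbb{Z}$, define $B_i=\llbracket 1+\sum_{j<i}\lambda_j,\ \sum_{j\le i}\lambda_j\rrbracket$. The symmetric discrete interval exchange $T_\lambda$ is the permutation of $\llbracket 1,n\rrbracket$ given by $T_\lambda(x)=x+s_i$ for $x\in B_i$. A composition $\lambda$ is circular if $T_\lambda$ has exactly one orbit. -}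

module Defs where

open import Data.Nat as ℕ using (ℕ; suc)
open import Data.Integer as ℤ using (ℤ; +_)
open import Data.List using (List; length; lookup; take; drop)
open import Data.Nat.ListAction using (sum)
open import Data.List.Relation.Unary.All using (All)
open import Data.Fin using (Fin; toℕ)
open import Data.Product using (Σ; _×_)
open import Relation.Binary.PropositionalEquality using (_≡_)
open import Relation.Binary.Construct.Closure.ReflexiveTransitive using (Star)

-- A composition: a list of positive integers (λ₁,…,λ_r); indices are 0-based Fin r.
IsComposition : List ℕ → Set
IsComposition ls = All (λ a → 1 ℕ.≤ a) ls

total : List ℕ → ℕ
total = sum

part : (ls : List ℕ) → Fin (length ls) → ℕ
part = lookup

pre : (ls : List ℕ) → Fin (length ls) → ℕ
pre ls i = sum (take (toℕ i) ls)

post : (ls : List ℕ) → Fin (length ls) → ℕ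
post ls i = sum (drop (suc (toℕ i)) ls)

s : (ls : List ℕ) → Fin (length ls) → ℤ
s ls i = + post ls i ℤ.- + pre ls i

InBlock : (ls : List ℕ) → Fin (length ls) → ℤ → Set
InBlock ls i x = (+ suc (pre ls i) ℤ.≤ x) × (x ℤ.≤ + (pre ls i ℕ.+ part ls i))

-- graph of T_λ : T x ≡ y  iff  x ∈ B_i and y = x + s_i for some i
TStep : List ℕ → ℤ → ℤ → Set
TStep ls x y = Σ (Fin (length ls)) λ i → InBlock ls i x × (y ≡ x ℤ.+ s ls i)

InRange : List ℕ → ℤ → Set
InRange ls x = (+ 1 ℤ.≤ x) × (x ℤ.≤ + total ls)

-- T_λ has exactly one orbit: ⟦1,n⟧ is nonempty and any y is reached from any x
-- by iterating T_λ.
Circular : List ℕ → Set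
Circular ls = (1 ℕ.≤ total ls) ×
  (∀ x y → InRange ls x → InRange ls y → Star (TStep ls) x y)

-- Write a = Σ_{j<t} λ_j and b = Σ_{j>t} λ_j, so that s_t = b - a; then λ_t > |s_t| says
-- a < b + λ_t and b < a + λ_t.  A block i to the left of t ends before block t starts
-- and sees all of block t on its right, hence
--   Σ_{j<i} λ_j + λ_i ≤ a < b + λ_t ≤ Σ_{j>i} λ_j,
-- i.e. λ_i < s_i; a block to the right of t gives λ_i < -s_i symmetrically.
module Submission where

open import Defs
open import Data.Nat using (_<_)
open import Data.Integer using (∣_∣)
open import Data.List using (List; length)
open import Data.Fin using (Fin)
open import Data.Nat using (ℕ)
open import Relation.Binary.PropositionalEquality using (_≢_)

open import Data.Nat using (zero; suc; _+_; _≤_; z≤n; s≤s; ∣_-_∣)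
open import Data.Nat.Properties
  using (≤-total; +-identityʳ; +-assoc; +-comm; +-monoˡ-≤; +-monoʳ-≤; +-monoʳ-<; +-cancelˡ-≤; +-cancelˡ-<;
         ∣-∣-comm; m≤n⇒∣m-n∣≡n∸m; m≤n⇒∣n-m∣≡n∸m; m≤n+∣n-m∣; m≤n+∣m-n∣; module ≤-Reasoning)
open import Data.Nat.ListAction using (sum)
open import Data.Nat.ListAction.Properties using (sum-++)
open import Data.Integer as ℤ using (_⊖_)
open import Data.Integer.Properties using (m-n≡m⊖n; ∣⊖∣-≤; ⊖-≥)
open import Data.List using ([]; _∷_; [_]; _++_; take; drop; lookup)
open import Data.List.Properties using (take++drop≡id; take-suc)
open import Data.Fin as Fin using (toℕ)
open import Data.Fin.Properties using (<-cmp)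
open import Data.Sum using (inj₁; inj₂)
open import Relation.Binary.Definitions using (Tri; tri<; tri≈; tri>)
open import Relation.Binary.PropositionalEquality
  using (_≡_; sym; trans; cong; subst; module ≡-Reasoning)
open import Relation.Nullary using (contradiction)

∣m⊖n∣≡∣m-n∣ : ∀ m n → ∣ m ⊖ n ∣ ≡ ∣ m - n ∣
∣m⊖n∣≡∣m-n∣ m n with ≤-total m n
... | inj₁ m≤n = trans (∣⊖∣-≤ m≤n) (sym (m≤n⇒∣m-n∣≡n∸m m≤n))
... | inj₂ n≤m = trans (cong ∣_∣ (⊖-≥ n≤m)) (sym (m≤n⇒∣n-m∣≡n∸m n≤m))

∣+m-+n∣≡∣m-n∣ : ∀ m n → ∣ ℤ.+ m ℤ.- ℤ.+ n ∣ ≡ ∣ m - n ∣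
∣+m-+n∣≡∣m-n∣ m n = trans (cong ∣_∣ (m-n≡m⊖n m n)) (∣m⊖n∣≡∣m-n∣ m n)

m+n≡o+p⇒m≤o⇒p≤n : ∀ {m n o p} → m + n ≡ o + p → m ≤ o → p ≤ n
m+n≡o+p⇒m≤o⇒p≤n {m} {n} {o} {p} eq m≤o =
  +-cancelˡ-≤ m p n (subst (m + p ≤_) (sym eq) (+-monoˡ-≤ p m≤o))

separated⇒<∣-∣ : ∀ {x m y a l b} → x + m ≤ a → ∣ b - a ∣ < l → b + l ≤ y → m < ∣ y - x ∣
separated⇒<∣-∣ {x} {m} {y} {a} {l} {b} x+m≤a ∣b-a∣<l b+l≤y =
  +-cancelˡ-< x m ∣ y - x ∣ (begin-strict
    x + m          ≤⟨ x+m≤a ⟩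
    a              ≤⟨ m≤n+∣n-m∣ a b ⟩
    b + ∣ b - a ∣  <⟨ +-monoʳ-< b ∣b-a∣<l ⟩
    b + l          ≤⟨ b+l≤y ⟩
    y              ≤⟨ m≤n+∣m-n∣ y x ⟩
    x + ∣ y - x ∣  ∎)
  where open ≤-Reasoning

sum-take+sum-drop : ∀ k (xs : List ℕ) → sum (take k xs) + sum (drop k xs) ≡ sum xs
sum-take+sum-drop k xs = trans (sym (sum-++ (take k xs) (drop k xs))) (cong sum (take++drop≡id k xs))

sum-take-mono : ∀ {m n} (xs : List ℕ) → m ≤ n → sum (take m xs) ≤ sum (take n xs)
sum-take-mono {zero}  xs       _         = z≤n
sum-take-mono {suc m} []       _         = z≤n
sum-take-mono {suc m} (x ∷ xs) (s≤s m≤n) = +-monoʳ-≤ x (sum-take-mono xs m≤n)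

pre+part≡sum-take : ∀ ls i → pre ls i + part ls i ≡ sum (take (suc (toℕ i)) ls)
pre+part≡sum-take ls i = begin
  sum (take (toℕ i) ls) + lookup ls i            ≡⟨ cong (sum (take (toℕ i) ls) +_) (sym (+-identityʳ _)) ⟩
  sum (take (toℕ i) ls) + sum [ lookup ls i ]    ≡⟨ sym (sum-++ (take (toℕ i) ls) _) ⟩
  sum (take (toℕ i) ls ++ [ lookup ls i ])       ≡⟨ cong sum (take-suc ls i) ⟨
  sum (take (suc (toℕ i)) ls)                    ∎
  where open ≡-Reasoning

pre+part+post≡total : ∀ ls i → pre ls i + part ls i + post ls i ≡ total ls
pre+part+post≡total ls i =
  trans (cong (_+ post ls i) (pre+part≡sum-take ls i)) (sum-take+sum-drop (suc (toℕ i)) ls)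

module _ (ls : List ℕ) {i j : Fin (length ls)} (i<j : i Fin.< j) where

  pre+part≤pre : pre ls i + part ls i ≤ pre ls j
  pre+part≤pre = subst (_≤ pre ls j) (sym (pre+part≡sum-take ls i)) (sum-take-mono ls i<j)

  post+part≤post : post ls j + part ls j ≤ post ls i
  post+part≤post = m+n≡o+p⇒m≤o⇒p≤n split pre+part≤pre
    where
    open ≡-Reasoning
    split : pre ls i + part ls i + post ls i ≡ pre ls j + (post ls j + part ls j)
    split = begin
      pre ls i + part ls i + post ls i    ≡⟨ pre+part+post≡total ls i ⟩
      total ls                            ≡⟨ pre+part+post≡total ls j ⟨
      pre ls j + part ls j + post ls j    ≡⟨ +-assoc (pre ls j) _ _ ⟩
      pre ls j + (part ls j + post ls j)  ≡⟨ cong (pre ls j +_) (+-comm (part ls j) _) ⟩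
      pre ls j + (post ls j + part ls j)  ∎

∣s∣≡∣post-pre∣ : ∀ ls i → ∣ s ls i ∣ ≡ ∣ post ls i - pre ls i ∣
∣s∣≡∣post-pre∣ ls i = ∣+m-+n∣≡∣m-n∣ (post ls i) (pre ls i)

lemma8 : (ls : List ℕ) → IsComposition ls → Circular ls →
    (t : Fin (length ls)) → ∣ s ls t ∣ < part ls t →
    (i : Fin (length ls)) → i ≢ t → part ls i < ∣ s ls i ∣
lemma8 ls _ _ t ∣sₜ∣<λₜ i i≢t =
  subst (part ls i <_) (sym (∣s∣≡∣post-pre∣ ls i)) (compare (<-cmp i t))
  where
  ∣postₜ-preₜ∣<λₜ : ∣ post ls t - pre ls t ∣ < part ls t
  ∣postₜ-preₜ∣<λₜ = subst (_< part ls t) (∣s∣≡∣post-pre∣ ls t) ∣sₜ∣<λₜ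

  compare : Tri (i Fin.< t) (i ≡ t) (t Fin.< i) → part ls i < ∣ post ls i - pre ls i ∣
  compare (tri< i<t _ _) =
    separated⇒<∣-∣ (pre+part≤pre ls i<t) ∣postₜ-preₜ∣<λₜ (post+part≤post ls i<t)
  compare (tri≈ _ i≡t _) = contradiction i≡t i≢t
  compare (tri> _ _ t<i) = subst (part ls i <_) (∣-∣-comm (pre ls i) (post ls i))
    (separated⇒<∣-∣ (post+part≤post ls t<i)
      (subst (_< part ls t) (∣-∣-comm (post ls t) (pre ls t)) ∣postₜ-preₜ∣<λₜ)
      (pre+part≤pre ls t<i))
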